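{- Let $n$ be a positive integer, let $d$ be a divisor of $n$ with $1<d<n$, and let $p$ be a prime. Let $I_{n,d}=\dfrac{n!}{(d!)^{n/d}\,(n/d)!}$. Then $p$ divides $I_{n,d}$ if and only if both of the following hold: (1) at least one carry is necessary when adding $n/d$ copies of $d$ in base $p$; and (2) $d$ is not a power of $p$.
   Context: $I_{n,d}$ is the number of partitions of an $n$-element set into $n/d$ blocks each of size $d$. "No carry is necessary when adding $m$ copies of $d$ in base $p$" means that every base-$p$ digit $d_i$ of $d$ satisfies $m\,d_i\le p-1$; otherwise at least one carry is necessary. -}

module Defs where

open import Data.Nat using (ℕ; zero; suc; _+_; _*_; _∸_; _^_; _≤_; NonZero)
open import Data.Nat.Base using (_!)
open import Data.Nat.DivMod using (_/_; _%_)
open import Data.Nat.Properties using (m^n≢0; m*n≢0; _!≢0)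
open import Data.Nat.Primality using (Prime)
open import Data.Product using (∃)
open import Relation.Binary.PropositionalEquality using (_≡_)
open import Relation.Nullary using (¬_)

denom : ℕ → ℕ → ℕ
denom d m = (d !) ^ m * (m !)

denom-nonZero : ∀ d m → NonZero (denom d m)
denom-nonZero d m = m*n≢0 ((d !) ^ m) (m !) {{m^n≢0 (d !) m {{d !≢0}}}} {{m !≢0}}

-- I n d m : number of partitions of an n-set into m blocks of size d (m = n/d)
-- given by the closed formula n! / ((d!)^m m!)
I : ℕ → ℕ → ℕ → ℕ
I n d m = ((n !) / denom d m) {{denom-nonZero d m}}

digit : (p : ℕ) → .{{NonZero p}} → ℕ → ℕ → ℕ
digit p x i = (x / p ^ i) {{m^n≢0 p i}} % p

-- no carry is necessary when adding m copies of x in base p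
NoCarry : (p : ℕ) → .{{NonZero p}} → ℕ → ℕ → Set
NoCarry p m x = ∀ i → m * digit p x i ≤ p ∸ 1

IsPowerOf : ℕ → ℕ → Set
IsPowerOf p x = ∃ λ k → x ≡ p ^ k

-- Write d = e + 1 and n = m·d. Telescoping n!/((d!)^m m!) gives I_{n,d} = ∏_{j<m} C(jd + e, e),
-- so a prime p divides I_{n,d} iff it divides one of these binomials. By Kummer's theorem
-- (derived here from Lucas' congruence C(N, K) ≡ C(N / p, K / p)·C(N mod p, K mod p)),
-- p ∤ C(jd + e, e) iff adding jd and d − 1 in base p needs no carry. Trailing zero digits of d
-- change neither this condition nor the two conditions of the theorem, so let the last digit r
-- of d be nonzero. By induction on m, the additions jd + (d − 1) for j < m are all carry-free iff
-- every digit d_i satisfies m·d_i ≤ p − 1, or d = 1: going from m to m + 1, the last digit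
-- requires (m + 1)·r ≤ p, and the boundary case (m + 1)·r = p forces r = 1 and m + 1 = p, after
-- which p·d_i ≤ p − 1 kills every higher digit.
module Submission where

open import Data.Nat
open import Data.Nat.Combinatorics
  using (_C_; nCk≡n!/k![n-k]!; k![n∸k]!∣n!; k>n⇒nCk≡0; nCn≡1; nCk+nC[k+1]≡[n+1]C[k+1])
open import Data.Nat.Divisibility
open import Data.Nat.DivMod
open import Data.Nat.Induction using (<-wellFounded)
open import Data.Nat.Primality
open import Data.Nat.Properties
open import Data.Nat.Tactic.RingSolver using (solve-∀)
open import Data.Product
open import Data.Sum
open import Data.Sum.Function.Propositional using (_⊎-⇔_)
open import Function using (_∘_)
open import Function.Bundles using (_⇔_; mk⇔; Equivalence)
open import Function.Construct.Composition using (_⇔-∘_)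
open import Function.Construct.Identity using (⇔-id)
open import Function.Construct.Symmetry using (⇔-sym)
open import Induction.WellFounded using (Acc; acc)
open import Relation.Binary.PropositionalEquality
  using (_≡_; refl; sym; trans; cong; cong₂; subst; subst₂; module ≡-Reasoning)
open import Relation.Nullary

open import Defs

open Equivalence using (to; from)

∏< : ℕ → (ℕ → ℕ) → ℕ
∏< zero    f = 1
∏< (suc m) f = ∏< m f * f m

∣∏< : ∀ {j m} (f : ℕ → ℕ) → j < m → f j ∣ ∏< m f
∣∏< {j} {suc m} f j<1+m with m≤n⇒m<n∨m≡n (≤-pred j<1+m)
... | inj₁ j<m  = ∣-trans (∣∏< f j<m) (m∣m*n (f m))
... | inj₂ refl = n∣m*n (∏< m f)

nCk*[k!*[n∸k]!]≡n! : ∀ {n k} → k ≤ n → (n C k) * (k ! * (n ∸ k) !) ≡ n !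
nCk*[k!*[n∸k]!]≡n! {n} {k} k≤n =
  trans (cong (_* (k ! * (n ∸ k) !)) (nCk≡n!/k![n-k]! k≤n)) (m/n*n≡m {{_}} (k![n∸k]!∣n! k≤n))

binomialProduct : ℕ → ℕ → ℕ
binomialProduct e m = ∏< m (λ j → (j * suc e + e) C e)

binomialProduct*denom≡! : ∀ e m → binomialProduct e m * denom (suc e) m ≡ (m * suc e) !
binomialProduct*denom≡! e zero    = refl
binomialProduct*denom≡! e (suc m) = begin
  (P * B) * ((suc e * e ! * (suc e !) ^ m) * (suc m * m !))
    ≡⟨ rearrange P B (e !) ((suc e !) ^ m) (m !) e m ⟩
  (B * (e ! * (P * ((suc e !) ^ m * m !)))) * (suc e * suc m)
    ≡⟨ cong (λ x → (B * (e ! * x)) * (suc e * suc m)) (binomialProduct*denom≡! e m) ⟩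
  (B * (e ! * (m * suc e) !)) * (suc e * suc m)
    ≡⟨ cong (_* (suc e * suc m)) B*[e!*[m*d]!]≡[m*d+e]! ⟩
  (m * suc e + e) ! * (suc e * suc m)
    ≡⟨ cong₂ (λ x y → x ! * y) (+-comm (m * suc e) e) (d*[1+m]≡1+[e+m*d] e m) ⟩
  (e + m * suc e) ! * suc (e + m * suc e)
    ≡⟨ *-comm ((e + m * suc e) !) (suc (e + m * suc e)) ⟩
  (suc m * suc e) ! ∎
  where
  open ≡-Reasoning
  P = binomialProduct e m
  B = (m * suc e + e) C e
  rearrange : ∀ P B E D M e m →
              (P * B) * ((suc e * E * D) * (suc m * M)) ≡ (B * (E * (P * (D * M)))) * (suc e * suc m)
  rearrange = solve-∀
  d*[1+m]≡1+[e+m*d] : ∀ e m → suc e * suc m ≡ suc (e + m * suc e)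
  d*[1+m]≡1+[e+m*d] = solve-∀
  B*[e!*[m*d]!]≡[m*d+e]! : B * (e ! * (m * suc e) !) ≡ (m * suc e + e) !
  B*[e!*[m*d]!]≡[m*d+e]! = trans (cong (λ x → B * (e ! * x !)) (sym (m+n∸n≡m (m * suc e) e)))
                                 (nCk*[k!*[n∸k]!]≡n! (m≤n+m e (m * suc e)))

I≡binomialProduct : ∀ e m → I (suc e * m) (suc e) m ≡ binomialProduct e m
I≡binomialProduct e m = begin
  (suc e * m) ! / denom (suc e) m
    ≡⟨ cong (λ x → x ! / denom (suc e) m) (*-comm (suc e) m) ⟩
  (m * suc e) ! / denom (suc e) m
    ≡⟨ cong (_/ denom (suc e) m) (binomialProduct*denom≡! e m) ⟨
  binomialProduct e m * denom (suc e) m / denom (suc e) m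
    ≡⟨ m*n/n≡m (binomialProduct e m) (denom (suc e) m) ⟩
  binomialProduct e m ∎
  where
  open ≡-Reasoning
  instance
    _ = denom-nonZero (suc e) m

lucasProduct : ℕ → ℕ → ℕ → ℕ → ℕ
lucasProduct q r Q s = (q C Q) * (r C s)

lucasProduct-pascal : ∀ q r Q s →
                      lucasProduct q r Q s + lucasProduct q r Q (suc s) ≡ lucasProduct q (suc r) Q (suc s)
lucasProduct-pascal q r Q s = trans (sym (*-distribˡ-+ (q C Q) (r C s) (r C suc s)))
                                    (cong ((q C Q) *_) (nCk+nC[k+1]≡[n+1]C[k+1] r s))

lucasProduct-pascal-wrapᵏ : ∀ q r Q s → r < s →
                            lucasProduct q r Q s + lucasProduct q r (suc Q) 0 ≡ lucasProduct q (suc r) (suc Q) 0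
lucasProduct-pascal-wrapᵏ q r Q s r<s = begin
  (q C Q) * (r C s) + (q C suc Q) * 1  ≡⟨ cong (λ x → (q C Q) * x + (q C suc Q) * 1) (k>n⇒nCk≡0 r<s) ⟩
  (q C Q) * 0 + (q C suc Q) * 1        ≡⟨ cong (_+ (q C suc Q) * 1) (*-zeroʳ (q C Q)) ⟩
  (q C suc Q) * 1                      ∎
  where open ≡-Reasoning

lucasProduct-pascal-wrap² : ∀ q Q r →
                            lucasProduct q r Q r + lucasProduct q r (suc Q) 0 ≡ lucasProduct (suc q) 0 (suc Q) 0
lucasProduct-pascal-wrap² q Q r = begin
  (q C Q) * (r C r) + (q C suc Q) * 1  ≡⟨ cong (λ x → (q C Q) * x + (q C suc Q) * 1) (nCn≡1 r) ⟩
  (q C Q) * 1 + (q C suc Q) * 1        ≡⟨ cong₂ _+_ (*-identityʳ (q C Q)) (*-identityʳ (q C suc Q)) ⟩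
  q C Q + q C suc Q                    ≡⟨ nCk+nC[k+1]≡[n+1]C[k+1] q Q ⟩
  suc q C suc Q                        ≡⟨ *-identityʳ (suc q C suc Q) ⟨
  (suc q C suc Q) * 1                  ∎
  where open ≡-Reasoning

c*[r+q*p]≡c*r+[c*q]*p : ∀ c r q p → c * (r + q * p) ≡ c * r + (c * q) * p
c*[r+q*p]≡c*r+[c*q]*p c r q p = trans (*-distribˡ-+ c r (q * p)) (cong (c * r +_) (sym (*-assoc c q p)))

m≤n∸1⇔m<n : ∀ {m} n → .{{NonZero n}} → (m ≤ n ∸ 1) ⇔ (m < n)
m≤n∸1⇔m<n (suc n) = mk⇔ s≤s ≤-pred

CarryFree : (p : ℕ) → .{{NonZero p}} → ℕ → ℕ → Set
CarryFree p a b = ∀ i → digit p a i + digit p b i < p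

MultiplesCarryFree : (p : ℕ) → .{{NonZero p}} → ℕ → ℕ → Set
MultiplesCarryFree p m d = ∀ j → j < m → CarryFree p (j * d) (d ∸ 1)

module NonZeroBase (p : ℕ) .{{_ : NonZero p}} where

  0<p : 0 < p
  0<p = >-nonZero⁻¹ p

  [r+q*p]%p≡r : ∀ {r} q → r < p → (r + q * p) % p ≡ r
  [r+q*p]%p≡r {r} q r<p = trans ([m+kn]%n≡m%n r q p) (m<n⇒m%n≡m r<p)

  [r+q*p]/p≡q : ∀ {r} q → r < p → (r + q * p) / p ≡ q
  [r+q*p]/p≡q {r} q r<p = begin
    (r + q * p) / p    ≡⟨ +-distrib-/-∣ʳ r (n∣m*n q) ⟩
    r / p + q * p / p  ≡⟨ cong₂ _+_ (m<n⇒m/n≡0 r<p) (m*n/n≡m q p) ⟩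
    q                  ∎
    where open ≡-Reasoning

  0%p≡0 : 0 % p ≡ 0
  0%p≡0 = [r+q*p]%p≡r 0 0<p

  0/p≡0 : 0 / p ≡ 0
  0/p≡0 = [r+q*p]/p≡q 0 0<p

  digit-zero : ∀ x → digit p x 0 ≡ x % p
  digit-zero x = cong (_% p) (n/1≡n x)

  digit-suc : ∀ x i → digit p x (suc i) ≡ digit p (x / p) i
  digit-suc x i = cong (_% p) (sym (m/n/o≡m/[n*o] x p (p ^ i) {{_}} {{m^n≢0 p i}} {{m^n≢0 p (suc i)}}))

  digit-+*-zero : ∀ {r} q → r < p → digit p (r + q * p) 0 ≡ r
  digit-+*-zero q r<p = trans (digit-zero _) ([r+q*p]%p≡r q r<p)

  digit-+*-suc : ∀ {r} q i → r < p → digit p (r + q * p) (suc i) ≡ digit p q i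
  digit-+*-suc q i r<p = trans (digit-suc _ i) (cong (λ x → digit p x i) ([r+q*p]/p≡q q r<p))

  digit<p : ∀ x i → digit p x i < p
  digit<p x i = m%n<n _ p

  digit-of-0 : ∀ i → digit p 0 i ≡ 0
  digit-of-0 i =
    trans (cong (_% p) (m<n⇒m/n≡0 {{m^n≢0 p i}} (>-nonZero⁻¹ (p ^ i) {{m^n≢0 p i}}))) 0%p≡0

  carryFree-+* : ∀ {r s} a b → r < p → s < p →
                 CarryFree p (r + a * p) (s + b * p) ⇔ (r + s < p × CarryFree p a b)
  carryFree-+* {r} {s} a b r<p s<p = mk⇔
    (λ cf → subst₂ Fits r′ s′ (cf 0) , λ i → subst₂ Fits (a′ i) (b′ i) (cf (suc i)))
    (λ { (r+s<p , cf) zero    → subst₂ Fits (sym r′) (sym s′) r+s<p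
       ; (r+s<p , cf) (suc i) → subst₂ Fits (sym (a′ i)) (sym (b′ i)) (cf i) })
    where
    Fits : ℕ → ℕ → Set
    Fits x y = x + y < p
    r′ = digit-+*-zero a r<p
    s′ = digit-+*-zero b s<p
    a′ = λ i → digit-+*-suc a i r<p
    b′ = λ i → digit-+*-suc b i s<p

  carryFree⇔ : ∀ a b → CarryFree p a b ⇔ (a % p + b % p < p × CarryFree p (a / p) (b / p))
  carryFree⇔ a b =
    subst₂ (λ x y → CarryFree p x y ⇔ (a % p + b % p < p × CarryFree p (a / p) (b / p)))
      (sym (m≡m%n+[m/n]*n a p)) (sym (m≡m%n+[m/n]*n b p))
      (carryFree-+* (a / p) (b / p) (m%n<n a p) (m%n<n b p))

  carryFree-0ʳ : ∀ a → CarryFree p a 0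
  carryFree-0ʳ a i = subst (λ x → digit p a i + x < p) (sym (digit-of-0 i))
                       (subst (_< p) (sym (+-identityʳ _)) (digit<p a i))

  noCarry-+* : ∀ m {r} q → r < p → NoCarry p m (r + q * p) ⇔ (m * r ≤ p ∸ 1 × NoCarry p m q)
  noCarry-+* m q r<p = mk⇔
    (λ nc → subst Fits (digit-+*-zero q r<p) (nc 0) , λ i → subst Fits (digit-+*-suc q i r<p) (nc (suc i)))
    (λ { (mr≤ , nc) zero    → subst Fits (sym (digit-+*-zero q r<p)) mr≤
       ; (mr≤ , nc) (suc i) → subst Fits (sym (digit-+*-suc q i r<p)) (nc i) })
    where
    Fits : ℕ → Set
    Fits x = m * x ≤ p ∸ 1

  noCarry⇔ : ∀ m x → NoCarry p m x ⇔ (m * (x % p) ≤ p ∸ 1 × NoCarry p m (x / p))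
  noCarry⇔ m x = subst (λ y → NoCarry p m y ⇔ (m * (x % p) ≤ p ∸ 1 × NoCarry p m (x / p)))
                       (sym (m≡m%n+[m/n]*n x p)) (noCarry-+* m (x / p) (m%n<n x p))

  noCarry-*p : ∀ m q → NoCarry p m (q * p) ⇔ NoCarry p m q
  noCarry-*p m q = mk⇔ (proj₂ ∘ to (noCarry-+* m q 0<p)) (λ nc → from (noCarry-+* m q 0<p) (m*0≤ , nc))
    where
    m*0≤ : m * 0 ≤ p ∸ 1
    m*0≤ = subst (_≤ p ∸ 1) (sym (*-zeroʳ m)) z≤n

  noCarry-mono : ∀ {c m} x → c ≤ m → NoCarry p m x → NoCarry p c x
  noCarry-mono x c≤m nc i = ≤-trans (*-monoˡ-≤ (digit p x i) c≤m) (nc i)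

  digit-* : ∀ c x → NoCarry p c x → ∀ i → digit p (c * x) i ≡ c * digit p x i
  digit-* c x nc i = trans (cong (λ y → digit p y i) c*x≡) (digits i)
    where
    c*r<p : c * (x % p) < p
    c*r<p = to (m≤n∸1⇔m<n p) (proj₁ (to (noCarry⇔ c x) nc))
    c*x≡ : c * x ≡ c * (x % p) + (c * (x / p)) * p
    c*x≡ = trans (cong (c *_) (m≡m%n+[m/n]*n x p)) (c*[r+q*p]≡c*r+[c*q]*p c (x % p) (x / p) p)
    digits : ∀ i → digit p (c * (x % p) + (c * (x / p)) * p) i ≡ c * digit p x i
    digits zero    = trans (digit-+*-zero (c * (x / p)) c*r<p) (cong (c *_) (sym (digit-zero x)))
    digits (suc i) = begin
      digit p (c * (x % p) + (c * (x / p)) * p) (suc i) ≡⟨ digit-+*-suc (c * (x / p)) i c*r<p ⟩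
      digit p (c * (x / p)) i                           ≡⟨ digit-* c (x / p) (proj₂ (to (noCarry⇔ c x) nc)) i ⟩
      c * digit p (x / p) i                             ≡⟨ cong (c *_) (digit-suc x i) ⟨
      c * digit p x (suc i)                             ∎
      where open ≡-Reasoning

  carryFree-*-self⇔ : ∀ c x → NoCarry p c x → CarryFree p (c * x) x ⇔ NoCarry p (suc c) x
  carryFree-*-self⇔ c x nc = mk⇔
    (λ cf i → from (m≤n∸1⇔m<n p) (subst (_< p) (sum≡ i) (cf i)))
    (λ nc′ i → subst (_< p) (sym (sum≡ i)) (to (m≤n∸1⇔m<n p) (nc′ i)))
    where
    sum≡ : ∀ i → digit p (c * x) i + digit p x i ≡ suc c * digit p x i
    sum≡ i = trans (cong (_+ digit p x i) (digit-* c x nc i)) (+-comm (c * digit p x i) (digit p x i))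

  multiplesCarryFree-1 : ∀ m → MultiplesCarryFree p m 1
  multiplesCarryFree-1 m j _ = carryFree-0ʳ (j * 1)

  multiplesCarryFree-*p : ∀ m q → MultiplesCarryFree p m (suc q * p) ⇔ MultiplesCarryFree p m (suc q)
  multiplesCarryFree-*p m q = mk⇔
    (λ mcf j j<m → proj₂ (to (lowest-digit j) (mcf j j<m)))
    (λ mcf j j<m → from (lowest-digit j) (p∸1<p , mcf j j<m))
    where
    p∸1<p : p ∸ 1 < p
    p∸1<p = to (m≤n∸1⇔m<n p) ≤-refl
    lowest-digit : ∀ j → CarryFree p (j * (suc q * p)) (suc q * p ∸ 1) ⇔
                         (p ∸ 1 < p × CarryFree p (j * suc q) q)
    lowest-digit j = subst₂ (λ x y → CarryFree p x y ⇔ (p ∸ 1 < p × CarryFree p (j * suc q) q))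
      (*-assoc j (suc q) p) (sym (+-∸-comm (q * p) 0<p)) (carryFree-+* (j * suc q) q 0<p p∸1<p)

  carryFree-*-pred⇔ : ∀ {t} j q → suc t < p → NoCarry p j (suc t + q * p) →
                      CarryFree p (j * (suc t + q * p)) (t + q * p) ⇔
                      (suc j * suc t ≤ p × NoCarry p (suc j) q)
  carryFree-*-pred⇔ {t} j q 1+t<p nc = mk⇔
    (λ cf → let low , high = to digits cf in
              subst (λ x → suc x ≤ p) (+-comm (j * suc t) t) low , to (carryFree-*-self⇔ j q ncq) high)
    (λ { (low , high) → from digits
              (subst (λ x → suc x ≤ p) (+-comm t (j * suc t)) low , from (carryFree-*-self⇔ j q ncq) high) })
    where
    ncq : NoCarry p j q
    ncq = proj₂ (to (noCarry-+* j q 1+t<p) nc)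
    j*[1+t]<p : j * suc t < p
    j*[1+t]<p = to (m≤n∸1⇔m<n p) (proj₁ (to (noCarry-+* j q 1+t<p) nc))
    digits : CarryFree p (j * (suc t + q * p)) (t + q * p) ⇔ (j * suc t + t < p × CarryFree p (j * q) q)
    digits = subst (λ x → CarryFree p x (t + q * p) ⇔ (j * suc t + t < p × CarryFree p (j * q) q))
      (sym (c*[r+q*p]≡c*r+[c*q]*p j (suc t) q p))
      (carryFree-+* (j * q) q j*[1+t]<p (<-trans (n<1+n t) 1+t<p))

  noCarry⇒multiplesCarryFree : ∀ {t} m q → suc t < p → NoCarry p m (suc t + q * p) →
                               MultiplesCarryFree p m (suc t + q * p)
  noCarry⇒multiplesCarryFree {t} m q 1+t<p nc j j<m =
    from (carryFree-*-pred⇔ j q 1+t<p (noCarry-mono (suc t + q * p) (<⇒≤ j<m) nc))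
         (≤-trans (*-monoˡ-≤ (suc t) j<m) (≤-trans m*[1+t]≤ (m∸n≤m p 1)) , noCarry-mono q j<m ncq)
    where
    m*[1+t]≤ : m * suc t ≤ p ∸ 1
    m*[1+t]≤ = proj₁ (to (noCarry-+* m q 1+t<p) nc)
    ncq : NoCarry p m q
    ncq = proj₂ (to (noCarry-+* m q 1+t<p) nc)

module NonTrivialBase (p : ℕ) .{{_ : NonTrivial p}} where

  private instance
    p-nonZero : NonZero p
    p-nonZero = nonTrivial⇒nonZero p

  open NonZeroBase p {{p-nonZero}}

  digits≡0⇒≡0 : ∀ x → (∀ i → digit p x i ≡ 0) → x ≡ 0
  digits≡0⇒≡0 x = go x (<-wellFounded x)
    where
    go : ∀ x → Acc _<_ x → (∀ i → digit p x i ≡ 0) → x ≡ 0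
    go zero      _         _     = refl
    go x@(suc _) (acc rec) zeros = begin
      x                  ≡⟨ m≡m%n+[m/n]*n x p ⟩
      x % p + x / p * p  ≡⟨ cong₂ (λ r q → r + q * p) x%p≡0 x/p≡0 ⟩
      0                  ∎
      where
      open ≡-Reasoning
      x%p≡0 : x % p ≡ 0
      x%p≡0 = trans (sym (digit-zero x)) (zeros 0)
      x/p≡0 : x / p ≡ 0
      x/p≡0 = go (x / p) (rec (m/n<m x p (nonTrivial⇒n>1 p)))
                 (λ i → trans (sym (digit-suc x i)) (zeros (suc i)))

  noCarry-p⇒≡0 : ∀ x → NoCarry p p x → x ≡ 0
  noCarry-p⇒≡0 x nc = digits≡0⇒≡0 x digit≡0
    where
    digit≡0 : ∀ i → digit p x i ≡ 0
    digit≡0 i with digit p x i | to (m≤n∸1⇔m<n p) (nc i)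
    ... | zero  | _     = refl
    ... | suc y | p*x<p = contradiction p*x<p (≤⇒≯ (m≤m*n p (suc y)))

  isPowerOf-*p : ∀ q → IsPowerOf p (q * p) ⇔ IsPowerOf p q
  isPowerOf-*p q = mk⇔ power (λ { (k , q≡p^k) → suc k , trans (cong (_* p) q≡p^k) (*-comm (p ^ k) p) })
    where
    power : IsPowerOf p (q * p) → IsPowerOf p q
    power (zero  , q*p≡1)     = contradiction (m*n≡1⇒n≡1 q p q*p≡1) nonTrivial⇒≢1
    power (suc k , q*p≡p^1+k) = k , *-cancelʳ-≡ q (p ^ k) p (trans q*p≡p^1+k (*-comm p (p ^ k)))

  isPowerOf-+* : ∀ {t} q → suc t < p → IsPowerOf p (suc t + q * p) ⇔ (suc t + q * p ≡ 1)
  isPowerOf-+* {t} q 1+t<p = mk⇔ power (0 ,_)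
    where
    power : IsPowerOf p (suc t + q * p) → suc t + q * p ≡ 1
    power (zero  , d≡1)     = d≡1
    power (suc k , d≡p^1+k) = contradiction (begin
      suc t                ≡⟨ [r+q*p]%p≡r q 1+t<p ⟨
      (suc t + q * p) % p  ≡⟨ cong (_% p) d≡p^1+k ⟩
      (p * p ^ k) % p      ≡⟨ cong (_% p) (*-comm p (p ^ k)) ⟩
      (p ^ k * p) % p      ≡⟨ m*n%n≡0 (p ^ k) p ⟩
      0                    ∎) (λ ())
      where open ≡-Reasoning

module PrimeBase (p : ℕ) (p-prime : Prime p) where

  private instance
    p-nonTrivial : NonTrivial p
    p-nonTrivial = prime⇒nonTrivial p-prime
    p-nonZero : NonZero p
    p-nonZero = nonTrivial⇒nonZero p

  open NonZeroBase p {{p-nonZero}}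
  open NonTrivialBase p {{p-nonTrivial}}

  prime∤1 : ¬ p ∣ 1
  prime∤1 p∣1 = nonTrivial⇒≢1 (∣1⇒≡1 p∣1)

  prime∤∏<⇔ : ∀ m f → (¬ p ∣ ∏< m f) ⇔ (∀ j → j < m → ¬ p ∣ f j)
  prime∤∏<⇔ m f = mk⇔ (λ p∤∏ j j<m p∣fj → p∤∏ (∣-trans p∣fj (∣∏< f j<m))) (coprime-factors m)
    where
    coprime-factors : ∀ m → (∀ j → j < m → ¬ p ∣ f j) → ¬ p ∣ ∏< m f
    coprime-factors zero    _   = prime∤1
    coprime-factors (suc m) p∤f p∣∏ with euclidsLemma (∏< m f) (f m) p-prime p∣∏
    ... | inj₁ p∣∏< = coprime-factors m (λ j j<m → p∤f j (m<n⇒m<1+n j<m)) p∣∏<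
    ... | inj₂ p∣fm = p∤f m (n<1+n m) p∣fm

  prime∤n! : ∀ {n} → n < p → ¬ p ∣ n !
  prime∤n! {zero}  _   = prime∤1
  prime∤n! {suc n} n<p p∣n! with euclidsLemma (suc n) (n !) p-prime p∣n!
  ... | inj₁ p∣1+n = <⇒≱ n<p (∣⇒≤ p∣1+n)
  ... | inj₂ p∣n!′ = prime∤n! (<-trans (n<1+n n) n<p) p∣n!′

  prime∤nCk : ∀ {n k} → k ≤ n → n < p → ¬ p ∣ n C k
  prime∤nCk k≤n n<p p∣nCk =
    prime∤n! n<p (subst (p ∣_) (nCk*[k!*[n∸k]!]≡n! k≤n) (∣-trans p∣nCk (m∣m*n _)))

  prime∣pCk : ∀ {k} → 0 < k → k < p → p ∣ p C k
  prime∣pCk {k} 0<k k<p with euclidsLemma (p C k) (k ! * (p ∸ k) !) p-prime p∣p!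
    where
    p∣p! : p ∣ (p C k) * (k ! * (p ∸ k) !)
    p∣p! = subst (p ∣_) (sym (nCk*[k!*[n∸k]!]≡n! (<⇒≤ k<p)))
             (subst (λ n → n ∣ n !) (suc-pred p) (m∣m*n (pred p !)))
  ... | inj₁ p∣pCk = p∣pCk
  ... | inj₂ p∣k!* with euclidsLemma (k !) ((p ∸ k) !) p-prime p∣k!*
  ... | inj₁ p∣k!      = contradiction p∣k! (prime∤n! k<p)
  ... | inj₂ p∣[p∸k]! = contradiction p∣[p∸k]! (prime∤n! (∸-monoʳ-< 0<k (<⇒≤ k<p)))

  divMod-suc : ∀ x → (suc (x % p) < p × suc x % p ≡ suc (x % p) × suc x / p ≡ x / p)
                   ⊎ (suc (x % p) ≡ p × suc x % p ≡ 0 × suc x / p ≡ suc (x / p))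
  divMod-suc x with suc (x % p) <? p
  ... | yes 1+r<p = inj₁ (1+r<p , trans (cong (_% p) 1+x≡) ([r+q*p]%p≡r (x / p) 1+r<p)
                                , trans (cong (_/ p) 1+x≡) ([r+q*p]/p≡q (x / p) 1+r<p))
    where
    1+x≡ : suc x ≡ suc (x % p) + x / p * p
    1+x≡ = cong suc (m≡m%n+[m/n]*n x p)
  ... | no  1+r≮p = inj₂ (1+r≡p , trans (cong (_% p) 1+x≡) ([r+q*p]%p≡r (suc (x / p)) 0<p)
                                , trans (cong (_/ p) 1+x≡) ([r+q*p]/p≡q (suc (x / p)) 0<p))
    where
    1+r≡p : suc (x % p) ≡ p
    1+r≡p = ≤-antisym (m%n<n x p) (≮⇒≥ 1+r≮p)
    1+x≡ : suc x ≡ 0 + suc (x / p) * p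
    1+x≡ = trans (cong suc (m≡m%n+[m/n]*n x p)) (cong (_+ x / p * p) 1+r≡p)

  lucasFactor : ℕ → ℕ → ℕ
  lucasFactor n k = lucasProduct (n / p) (n % p) (k / p) (k % p)

  prime∣lucasProduct-pascal : ∀ q r Q s → suc r ≡ p → suc s < p →
                              p ∣ lucasProduct q r Q s + lucasProduct q r Q (suc s)
  prime∣lucasProduct-pascal q r Q s 1+r≡p 1+s<p = begin
    p                                  ∣⟨ subst (λ x → p ∣ x C suc s) (sym 1+r≡p) (prime∣pCk z<s 1+s<p) ⟩
    suc r C suc s                      ∣⟨ n∣m*n (q C Q) ⟩
    lucasProduct q (suc r) Q (suc s)   ≡⟨ lucasProduct-pascal q r Q s ⟨
    lucasProduct q r Q s + lucasProduct q r Q (suc s) ∎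
    where open ∣-Reasoning

  -- Exact in every case but one: when the last digit of n wraps around, both sides vanish mod p.
  lucasFactor-pascal : ∀ n k → (lucasFactor n k + lucasFactor n (suc k)) % p ≡ lucasFactor (suc n) (suc k) % p
  lucasFactor-pascal n k with divMod-suc n | divMod-suc k
  ... | inj₁ (_ , n%≡ , n/≡) | inj₁ (_ , k%≡ , k/≡) rewrite n%≡ | n/≡ | k%≡ | k/≡ =
    cong (_% p) (lucasProduct-pascal (n / p) (n % p) (k / p) (k % p))
  ... | inj₁ (1+r<p , n%≡ , n/≡) | inj₂ (1+s≡p , k%≡ , k/≡) rewrite n%≡ | n/≡ | k%≡ | k/≡ =
    cong (_% p) (lucasProduct-pascal-wrapᵏ (n / p) (n % p) (k / p) (k % p)
                   (≤-pred (subst (suc (n % p) <_) (sym 1+s≡p) 1+r<p)))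
  ... | inj₂ (1+r≡p , n%≡ , n/≡) | inj₁ (1+s<p , k%≡ , k/≡) rewrite n%≡ | n/≡ | k%≡ | k/≡ = begin
    (lucasProduct q r Q s + lucasProduct q r Q (suc s)) % p
      ≡⟨ n∣m⇒m%n≡0 _ p (prime∣lucasProduct-pascal q r Q s 1+r≡p 1+s<p) ⟩
    0                                     ≡⟨ 0%p≡0 ⟨
    0 % p                                 ≡⟨ cong (_% p) (*-zeroʳ (suc q C Q)) ⟨
    lucasProduct (suc q) 0 Q (suc s) % p  ∎
    where
    open ≡-Reasoning
    q = n / p
    r = n % p
    Q = k / p
    s = k % p
  ... | inj₂ (1+r≡p , n%≡ , n/≡) | inj₂ (1+s≡p , k%≡ , k/≡) rewrite n%≡ | n/≡ | k%≡ | k/≡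
        | suc-injective (trans 1+r≡p (sym 1+s≡p)) =
    cong (_% p) (lucasProduct-pascal-wrap² (n / p) (k / p) (k % p))

  lucasFactor-0-suc : ∀ k → lucasFactor 0 (suc k) ≡ 0
  lucasFactor-0-suc k rewrite 0/p≡0 | 0%p≡0 with suc k % p in r≡ | suc k / p in q≡
  ... | suc _ | q     = *-zeroʳ (0 C q)
  ... | zero  | suc _ = refl
  ... | zero  | zero  =
    contradiction (trans (m≡m%n+[m/n]*n (suc k) p) (cong₂ (λ r q → r + q * p) r≡ q≡)) λ ()

  lucas : ∀ n k → (n C k) % p ≡ lucasFactor n k % p
  lucas n       zero    rewrite 0/p≡0 | 0%p≡0 = refl
  lucas zero    (suc k) = trans 0%p≡0 (sym (trans (cong (_% p) (lucasFactor-0-suc k)) 0%p≡0))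
  lucas (suc n) (suc k) = begin
    (suc n C suc k) % p
      ≡⟨ cong (_% p) (nCk+nC[k+1]≡[n+1]C[k+1] n k) ⟨
    (n C k + n C suc k) % p
      ≡⟨ %-distribˡ-+ (n C k) (n C suc k) p ⟩
    ((n C k) % p + (n C suc k) % p) % p
      ≡⟨ cong₂ (λ x y → (x + y) % p) (lucas n k) (lucas n (suc k)) ⟩
    (lucasFactor n k % p + lucasFactor n (suc k) % p) % p
      ≡⟨ %-distribˡ-+ (lucasFactor n k) (lucasFactor n (suc k)) p ⟨
    (lucasFactor n k + lucasFactor n (suc k)) % p
      ≡⟨ lucasFactor-pascal n k ⟩
    lucasFactor (suc n) (suc k) % p ∎
    where open ≡-Reasoning

  prime∣C⇔prime∣lucasFactor : ∀ n k → p ∣ n C k ⇔ p ∣ lucasFactor n k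
  prime∣C⇔prime∣lucasFactor n k = mk⇔
    (λ p∣C → m%n≡0⇒n∣m _ p (trans (sym (lucas n k)) (n∣m⇒m%n≡0 _ p p∣C)))
    (λ p∣L → m%n≡0⇒n∣m _ p (trans (lucas n k) (n∣m⇒m%n≡0 _ p p∣L)))

  lucasFactor-noCarry : ∀ a b → a % p + b % p < p →
                        lucasFactor (a + b) b ≡ lucasProduct (a / p + b / p) (a % p + b % p) (b / p) (b % p)
  lucasFactor-noCarry a b no-carry = cong₂ (λ q r → lucasProduct q r (b / p) (b % p))
    (+-distrib-/ a b no-carry) (trans (%-distribˡ-+ a b p) (m<n⇒m%n≡m no-carry))

  lucasFactor-carry : ∀ a b → p ≤ a % p + b % p → lucasFactor (a + b) b ≡ 0
  lucasFactor-carry a b carry =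
    trans (cong (((a + b) / p C (b / p)) *_) (k>n⇒nCk≡0 [a+b]%p<b%p)) (*-zeroʳ ((a + b) / p C (b / p)))
    where
    sum∸p<b%p : a % p + b % p ∸ p < b % p
    sum∸p<b%p = subst (a % p + b % p ∸ p <_) (m+n∸m≡n p (b % p))
                      (∸-monoˡ-< (+-monoˡ-< (b % p) (m%n<n a p)) carry)
    [a+b]%p<b%p : (a + b) % p < b % p
    [a+b]%p<b%p = subst (_< b % p) (sym (begin
      (a + b) % p              ≡⟨ %-distribˡ-+ a b p ⟩
      (a % p + b % p) % p      ≡⟨ m≤n⇒[n∸m]%m≡n%m carry ⟨
      (a % p + b % p ∸ p) % p  ≡⟨ m<n⇒m%n≡m (<-trans sum∸p<b%p (m%n<n b p)) ⟩
      a % p + b % p ∸ p        ∎)) sum∸p<b%p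
      where open ≡-Reasoning

  kummer : ∀ a b → (¬ p ∣ (a + b) C b) ⇔ CarryFree p a b
  kummer a b = kummer-acc a b (<-wellFounded b)
    where
    kummer-acc : ∀ a b → Acc _<_ b → (¬ p ∣ (a + b) C b) ⇔ CarryFree p a b
    kummer-acc a zero      _         = mk⇔ (λ _ → carryFree-0ʳ a) (λ _ → prime∤1)
    kummer-acc a b@(suc _) (acc rec) with a % p + b % p <? p
    ... | no carry = mk⇔
      (contradiction p∣C)
      (λ cf → contradiction (proj₁ (to (carryFree⇔ a b) cf)) carry)
      where
      p∣C : p ∣ (a + b) C b
      p∣C = from (prime∣C⇔prime∣lucasFactor (a + b) b)
                 (subst (p ∣_) (sym (lucasFactor-carry a b (≮⇒≥ carry))) (p ∣0))
    ... | yes no-carry = mk⇔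
      (λ p∤C → from (carryFree⇔ a b)
                 (no-carry , to higher (λ p∣C′ → p∤C (from p∣C⇔ (∣-trans p∣C′ (m∣m*n _))))))
      (λ cf p∣C → [ from higher (proj₂ (to (carryFree⇔ a b) cf)) , lowest ]
                    (euclidsLemma _ _ p-prime (to p∣C⇔ p∣C)))
      where
      p∣C⇔ : p ∣ (a + b) C b ⇔ p ∣ lucasProduct (a / p + b / p) (a % p + b % p) (b / p) (b % p)
      p∣C⇔ = subst (λ x → p ∣ (a + b) C b ⇔ p ∣ x) (lucasFactor-noCarry a b no-carry)
                   (prime∣C⇔prime∣lucasFactor (a + b) b)
      higher : (¬ p ∣ (a / p + b / p) C (b / p)) ⇔ CarryFree p (a / p) (b / p)
      higher = kummer-acc (a / p) (b / p) (rec (m/n<m b p (nonTrivial⇒n>1 p)))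
      lowest : ¬ p ∣ (a % p + b % p) C (b % p)
      lowest = prime∤nCk (m≤n+m (b % p) (a % p)) no-carry

  multiplesCarryFree⇒ : ∀ {t} m q → suc t < p → MultiplesCarryFree p m (suc t + q * p) →
                        NoCarry p m (suc t + q * p) ⊎ suc t + q * p ≡ 1
  multiplesCarryFree⇒ zero q _ _ = inj₁ (λ _ → z≤n)
  multiplesCarryFree⇒ {t} (suc m) q 1+t<p mcf
    with multiplesCarryFree⇒ m q 1+t<p (λ j j<m → mcf j (m<n⇒m<1+n j<m))
  ... | inj₂ d≡1 = inj₂ d≡1
  ... | inj₁ nc with to (carryFree-*-pred⇔ m q 1+t<p nc) (mcf m (n<1+n m))
  ... | [1+m]*[1+t]≤p , nc′ with m≤n⇒m<n∨m≡n [1+m]*[1+t]≤p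
  ... | inj₁ [1+m]*[1+t]<p =
    inj₁ (from (noCarry-+* (suc m) q 1+t<p) (from (m≤n∸1⇔m<n p) [1+m]*[1+t]<p , nc′))
  ... | inj₂ [1+m]*[1+t]≡p = inj₂ (cong₂ (λ r q → r + q * p) 1+t≡1 q≡0)
    where
    1+t≡1 : suc t ≡ 1
    1+t≡1 = [ (λ 1+t≡1 → 1+t≡1) , (λ 1+t≡p → contradiction 1+t≡p (<⇒≢ 1+t<p)) ]
      (prime⇒irreducible p-prime (divides (suc m) (sym [1+m]*[1+t]≡p)))
    1+m≡p : suc m ≡ p
    1+m≡p = trans (sym (*-identityʳ (suc m))) (trans (cong (suc m *_) (sym 1+t≡1)) [1+m]*[1+t]≡p)
    q≡0 : q ≡ 0
    q≡0 = noCarry-p⇒≡0 q (subst (λ c → NoCarry p c q) 1+m≡p nc′)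

  multiplesCarryFree-+*⇔ : ∀ {t} m q → suc t < p →
                           MultiplesCarryFree p m (suc t + q * p) ⇔
                           (NoCarry p m (suc t + q * p) ⊎ suc t + q * p ≡ 1)
  multiplesCarryFree-+*⇔ m q 1+t<p = mk⇔ (multiplesCarryFree⇒ m q 1+t<p)
    [ noCarry⇒multiplesCarryFree m q 1+t<p
    , (λ d≡1 → subst (MultiplesCarryFree p m) (sym d≡1) (multiplesCarryFree-1 m)) ]

  multiplesCarryFree⇔ : ∀ m d → 0 < d → MultiplesCarryFree p m d ⇔ (NoCarry p m d ⊎ IsPowerOf p d)
  multiplesCarryFree⇔ m d 0<d = go d (<-wellFounded d) 0<d
    where
    Characterisation : ℕ → Set
    Characterisation d = MultiplesCarryFree p m d ⇔ (NoCarry p m d ⊎ IsPowerOf p d)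

    go : ∀ d → Acc _<_ d → 0 < d → Characterisation d
    go d (acc rec) 0<d
      with d % p | d / p | m≡m%n+[m/n]*n d p | m%n<n d p | m/n<m d p {{>-nonZero 0<d}} (nonTrivial⇒n>1 p)
    ... | zero  | zero  | d≡0 | _     | _   = contradiction d≡0 (>⇒≢ 0<d)
    ... | zero  | suc q | d≡  | _     | q<d = subst Characterisation (sym d≡)
      (⇔-sym (noCarry-*p m (suc q) ⊎-⇔ isPowerOf-*p (suc q))
        ⇔-∘ (go (suc q) (rec q<d) z<s ⇔-∘ multiplesCarryFree-*p m q))
    ... | suc t | q     | d≡  | 1+t<p | _   = subst Characterisation (sym d≡)
      (⇔-sym (⇔-id _ ⊎-⇔ isPowerOf-+* q 1+t<p) ⇔-∘ multiplesCarryFree-+*⇔ m q 1+t<p)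

  prime∤binomialProduct⇔ : ∀ e m → (¬ p ∣ binomialProduct e m) ⇔ MultiplesCarryFree p m (suc e)
  prime∤binomialProduct⇔ e m = mk⇔
    (λ p∤∏ j j<m → to (kummer (j * suc e) e) (to (prime∤∏<⇔ m _) p∤∏ j j<m))
    (λ mcf → from (prime∤∏<⇔ m _) (λ j j<m → from (kummer (j * suc e) e) (mcf j j<m)))

lemma3p2 : (n d m p : ℕ) → .{{_ : NonZero p}} → 0 < n → n ≡ d * m → 1 < d → d < n → Prime p →
    ((p ∣ I n d m) ⇔ ((¬ NoCarry p m d) × (¬ IsPowerOf p d)))
lemma3p2 .(suc e * m) (suc e) m p _ refl _ _ p-prime =
  subst (λ x → (p ∣ x) ⇔ ((¬ NoCarry p m (suc e)) × (¬ IsPowerOf p (suc e))))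
    (sym (I≡binomialProduct e m))
    (mk⇔ (λ p∣∏ → (λ nc → from p∤∏⇔ (inj₁ nc) p∣∏) , (λ pow → from p∤∏⇔ (inj₂ pow) p∣∏))
         (λ { (¬nc , ¬pow) → decidable-stable (p ∣? binomialProduct e m) ([ ¬nc , ¬pow ] ∘ to p∤∏⇔) }))
  where
  open PrimeBase p p-prime
  p∤∏⇔ : (¬ p ∣ binomialProduct e m) ⇔ (NoCarry p m (suc e) ⊎ IsPowerOf p (suc e))
  p∤∏⇔ = multiplesCarryFree⇔ m (suc e) z<s ⇔-∘ prime∤binomialProduct⇔ e m
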